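{- Let $a,d,h$ be positive integers with $\gcd(a,d)=1$ and $ha-d>1$, let $A=(a,\ ha-d,\ ha+d)$, $r_1=\lfloor \frac{ha-d}{2h}\rfloor$, and $f(x)=\sum_{r=0}^{a-1}x^{N_r}$. Then $$f(x)=\frac{1-x^{(ha+d)(r_1+1)}}{1-x^{ha+d}}+\frac{x^{ha-d}\big(1-x^{(ha-d)(a-r_1-1)}\big)}{1-x^{ha-d}}.$$
   Context: For $A=(a,b_1,\dots,b_k)$ with $\gcd(A)=1$ and $0\le r\le a-1$, $N_r=\min\{a_0\in\mathbb{N} : a_0\equiv r \pmod a,\ a_0=\sum_{i}b_ix_i \text{ for some } x_i\in\mathbb{N}\}$ (here $(b_1,\dots,b_k)$ are the entries of $A$ other than the first). -}

module Defs where

import Data.Nat.Properties as NP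
open import Data.Nat as ℕ using (ℕ; zero; suc; _+_; _*_; _∸_; _<_; _≤_; _/_; >-nonZero)
open import Data.Integer as ℤ using (ℤ; +_)
open import Data.List using (List; []; _∷_; upTo; map; foldr)
open import Data.Product using (Σ; ∃; _×_)
open import Relation.Binary.PropositionalEquality using (_≡_)

Rep : List ℕ → ℕ → Set
Rep []       n = n ≡ 0
Rep (b ∷ bs) n = Σ ℕ λ x → Σ ℕ λ m → Rep bs m × n ≡ b * x + m

CongMod : ℕ → ℕ → ℕ → Set
CongMod n r a = Σ ℕ λ k → n ≡ r + k * a

-- IsN a bs r n : n is N_r for A = (a, bs), i.e. the least natural number
-- congruent to r mod a that is representable by bs.
IsN : ℕ → List ℕ → ℕ → ℕ → Set
IsN a bs r n = CongMod n r a × Rep bs n ×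
               (∀ m → CongMod m r a → Rep bs m → n ≤ m)

floorDiv : (m n : ℕ) → 0 < n → ℕ
floorDiv m n p = _/_ m n {{>-nonZero p}}

f : (N : ℕ → ℕ) → ℕ → ℤ → ℤ
f N a x = foldr (λ r acc → (x ℤ.^ N r) ℤ.+ acc) (+ 0) (upTo a)

r₁ : (a d h : ℕ) → 0 < h → ℕ
r₁ a d h hh = floorDiv (h * a ∸ d) (2 * h) (NP.*-monoʳ-< 2 hh)

-- Write b = ha − d and c = ha + d, so that b + c = 2h·a, and R = r₁ = ⌊b / 2h⌋.  Each N_r has
-- a representation b·x + c·y, and by minimality no positive multiple of a can be split off it.
-- This excludes x, y > 0 (split off b + c = 2h·a), x ≥ a and y ≥ a, and c·y with R < y < a,
-- since c·y = b·(a − y) + (2hy − b)·a; and for b·x with x < a ≤ R + x it forces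
-- b·x = c·(a − x) + (b − 2h(a − x))·a to collapse to c·(a − x).  So every N_r is one of the
-- a numbers c·0, …, c·R, b·1, …, b·(a − R − 1); the N_r are distinct, being in distinct residue
-- classes, hence they are exactly these numbers, and f is a sum of two geometric progressions.
module Submission where

open import Data.Nat as ℕ using (ℕ; zero; suc)
import Data.Nat.Properties as ℕₚ
open import Data.List using (_∷_; []; foldr; applyUpTo)
open import Data.Fin using (Fin; toℕ; fromℕ<; punchOut)
open import Data.Fin.Properties using (toℕ<n; toℕ-fromℕ<; toℕ-injective; punchOut-injective; any?; injective⇒≤)
  renaming (_≟_ to _≟ᶠ_)
open import Data.Fin.Permutation using (permutation)
open import Data.Product using (∃; ∃₂; _×_; _,_; proj₁; proj₂)
open import Function using (_∘_; id)
open import Function.Definitions using (Injective)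
open import Relation.Nullary using (yes; no; contradiction)
open import Relation.Binary.PropositionalEquality

injective⇒surjective : ∀ {n} (τ : Fin n → Fin n) → Injective _≡_ _≡_ τ → ∀ j → ∃ λ i → τ i ≡ j
injective⇒surjective {zero}  τ τ-inj ()
injective⇒surjective {suc n} τ τ-inj j with any? (λ i → τ i ≟ᶠ j)
... | yes hit = hit
... | no miss = contradiction (injective⇒≤ φ-inj) ℕₚ.1+n≰n
  where
  φ : Fin (suc n) → Fin n
  φ i = punchOut {i = j} {j = τ i} (λ eq → miss (i , sym eq))
  φ-inj : Injective _≡_ _≡_ φ
  φ-inj {i} {i′} eq = τ-inj (punchOut-injective (λ e → miss (i , sym e)) (λ e → miss (i′ , sym e)) eq)

module IntegerSums where

  open import Data.Integer using (ℤ; +_; _+_; _-_; _*_; _^_)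
  open import Data.Integer.Properties using (+-identityˡ; +-assoc; *-zeroʳ; *-distribˡ-+; +-0-commutativeMonoid)
  open import Data.Integer.Tactic.RingSolver using (solve-∀)
  import Algebra.Properties.CommutativeMonoid.Sum as MonoidSum

  module FinSum = MonoidSum +-0-commutativeMonoid

  ∑ : ℕ → (ℕ → ℤ) → ℤ
  ∑ zero    g = + 0
  ∑ (suc n) g = g 0 + ∑ n (g ∘ suc)

  foldr-applyUpTo≡∑ : ∀ (g : ℕ → ℤ) (h : ℕ → ℕ) n →
                      foldr (λ i acc → g i + acc) (+ 0) (applyUpTo h n) ≡ ∑ n (g ∘ h)
  foldr-applyUpTo≡∑ g h zero    = refl
  foldr-applyUpTo≡∑ g h (suc n) = cong (_+_ (g (h 0))) (foldr-applyUpTo≡∑ g (h ∘ suc) n)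

  sum≡∑ : ∀ (g : ℕ → ℤ) n → FinSum.sum {n} (g ∘ toℕ) ≡ ∑ n g
  sum≡∑ g zero    = refl
  sum≡∑ g (suc n) = cong (_+_ (g 0)) (sum≡∑ (g ∘ suc) n)

  ∑-cong : ∀ {g g′ : ℕ → ℤ} n → (∀ {i} → i ℕ.< n → g i ≡ g′ i) → ∑ n g ≡ ∑ n g′
  ∑-cong zero    eq = refl
  ∑-cong (suc n) eq = cong₂ _+_ (eq ℕₚ.0<1+n) (∑-cong n (eq ∘ ℕ.s<s))

  ∑-+ : ∀ (g : ℕ → ℤ) m n → ∑ (m ℕ.+ n) g ≡ ∑ m g + ∑ n (λ i → g (m ℕ.+ i))
  ∑-+ g zero    n = sym (+-identityˡ _)
  ∑-+ g (suc m) n = trans (cong (_+_ (g 0)) (∑-+ (g ∘ suc) m n)) (sym (+-assoc (g 0) _ _))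

  ∑-*ˡ : ∀ k (g : ℕ → ℤ) n → ∑ n (λ i → k * g i) ≡ k * ∑ n g
  ∑-*ˡ k g zero    = sym (*-zeroʳ k)
  ∑-*ˡ k g (suc n) = trans (cong (_+_ (k * g 0)) (∑-*ˡ k (g ∘ suc) n)) (sym (*-distribˡ-+ k (g 0) _))

  geometric : ∀ y n → ∑ n (y ^_) * (+ 1 - y) ≡ + 1 - y ^ n
  geometric y zero    = refl
  geometric y (suc n) = begin
    (+ 1 + ∑ n (λ i → y * y ^ i)) * (+ 1 - y) ≡⟨ cong (λ s → (+ 1 + s) * (+ 1 - y)) (∑-*ˡ y (y ^_) n) ⟩
    (+ 1 + y * ∑ n (y ^_)) * (+ 1 - y)        ≡⟨ telescope y (∑ n (y ^_)) ⟩
    + 1 - y + y * (∑ n (y ^_) * (+ 1 - y))    ≡⟨ cong (λ s → + 1 - y + y * s) (geometric y n) ⟩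
    + 1 - y + y * (+ 1 - y ^ n)               ≡⟨ collapse y (y ^ n) ⟩
    + 1 - y * y ^ n                           ∎
    where
    open ≡-Reasoning
    telescope : ∀ y s → (+ 1 + y * s) * (+ 1 - y) ≡ + 1 - y + y * (s * (+ 1 - y))
    telescope = solve-∀
    collapse : ∀ y z → + 1 - y + y * (+ 1 - z) ≡ + 1 - y * z
    collapse = solve-∀

  two-geometric-blocks : ∀ y z k m →
    (∑ k (y ^_) + z * ∑ m (z ^_)) * ((+ 1 - y) * (+ 1 - z))
    ≡ (+ 1 - y ^ k) * (+ 1 - z) + z * (+ 1 - z ^ m) * (+ 1 - y)
  two-geometric-blocks y z k m = begin
    (Y + z * Z) * ((+ 1 - y) * (+ 1 - z))              ≡⟨ distribute Y Z y z ⟩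
    Y * (+ 1 - y) * (+ 1 - z) + z * (Z * (+ 1 - z)) * (+ 1 - y)
      ≡⟨ cong₂ (λ s t → s * (+ 1 - z) + z * t * (+ 1 - y)) (geometric y k) (geometric z m) ⟩
    (+ 1 - y ^ k) * (+ 1 - z) + z * (+ 1 - z ^ m) * (+ 1 - y) ∎
    where
    open ≡-Reasoning
    Y Z : ℤ
    Y = ∑ k (y ^_)
    Z = ∑ m (z ^_)
    distribute : ∀ Y Z y z → (Y + z * Z) * ((+ 1 - y) * (+ 1 - z))
                           ≡ Y * (+ 1 - y) * (+ 1 - z) + z * (Z * (+ 1 - z)) * (+ 1 - y)
    distribute = solve-∀

  sum-reindex : ∀ {n} (τ : Fin n → Fin n) → Injective _≡_ _≡_ τ → (G : Fin n → ℤ) →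
                FinSum.sum G ≡ FinSum.sum (G ∘ τ)
  sum-reindex {n} τ τ-inj G =
    FinSum.sum-permute G (permutation τ τ⁻¹ (proj₂ ∘ surj) (λ i → τ-inj (proj₂ (surj (τ i)))))
    where
    surj : ∀ j → ∃ λ i → τ i ≡ j
    surj = injective⇒surjective τ τ-inj
    τ⁻¹ : Fin n → Fin n
    τ⁻¹ = proj₁ ∘ surj

open import Defs
open import Data.Nat using (_+_; _*_; _∸_; _<_; _≤_; z≤n; _≤?_; _<?_; NonZero; >-nonZero)
open ℕₚ
open import Data.Nat.DivMod using (_%_; _/_; m≡m%n+[m/n]*n; m%n<n; m/n*n≤m; [m+kn]%n≡m%n; m<n⇒m%n≡m)
open import Data.Nat.GCD using (gcd)
import Data.Nat.Tactic.RingSolver as ℕ-Solver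
open import Data.Integer as ℤ using (ℤ; +_)
import Data.Integer.Properties as ℤₚ
open IntegerSums

Rep-pair : ∀ b c x y → Rep (b ∷ c ∷ []) (b * x + c * y)
Rep-pair b c x y = x , c * y + 0 , (y , 0 , refl , refl) , cong (_+_ (b * x)) (sym (+-identityʳ _))

Rep-pair⁻¹ : ∀ {b c n} → Rep (b ∷ c ∷ []) n → ∃₂ λ x y → n ≡ b * x + c * y
Rep-pair⁻¹ {b} {c} (x , _ , (y , _ , refl , refl) , refl) = x , y , cong (_+_ (b * x)) (+-identityʳ (c * y))

Rep-left : ∀ b c x → Rep (b ∷ c ∷ []) (b * x)
Rep-left b c x = subst (Rep (b ∷ c ∷ [])) b*x+c*0≡b*x (Rep-pair b c x 0)
  where
  b*x+c*0≡b*x : b * x + c * 0 ≡ b * x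
  b*x+c*0≡b*x = ℕ-Solver.solve (b ∷ c ∷ x ∷ [])

Rep-right : ∀ b c y → Rep (b ∷ c ∷ []) (c * y)
Rep-right b c y = subst (Rep (b ∷ c ∷ [])) b*0+c*y≡c*y (Rep-pair b c 0 y)
  where
  b*0+c*y≡c*y : b * 0 + c * y ≡ c * y
  b*0+c*y≡c*y = ℕ-Solver.solve (b ∷ c ∷ y ∷ [])

CongMod-cancel : ∀ {a r n m} t → CongMod n r a → r < a → m + t * a ≡ n → CongMod m r a
CongMod-cancel {a} {r} {n} {m} t (k , n≡r+ka) r<a m+ta≡n with t ≤? k
... | yes t≤k = k ∸ t , +-cancelʳ-≡ (t * a) _ _ (begin
      m + t * a               ≡⟨ trans m+ta≡n n≡r+ka ⟩
      r + k * a               ≡⟨ cong (λ s → r + s * a) (sym (m+[n∸m]≡n t≤k)) ⟩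
      r + (t + (k ∸ t)) * a   ≡⟨ shuffle r t (k ∸ t) a ⟩
      r + (k ∸ t) * a + t * a ∎)
  where
  open ≡-Reasoning
  shuffle : ∀ r t u a → r + (t + u) * a ≡ r + u * a + t * a
  shuffle = ℕ-Solver.solve-∀
... | no t≰k = contradiction (<-≤-trans r+ka<ta ta≤n) (≤⇒≯ (≤-reflexive n≡r+ka))
  where
  r+ka<ta : r + k * a < t * a
  r+ka<ta = <-≤-trans (+-monoˡ-< (k * a) r<a) (*-monoˡ-≤ a (≰⇒> t≰k))
  ta≤n : t * a ≤ n
  ta≤n = ≤-trans (m≤n+m (t * a) m) (≤-reflexive m+ta≡n)

CongMod-residue-unique : ∀ {a n r r′} .{{_ : NonZero a}} → r < a → r′ < a →
                         CongMod n r a → CongMod n r′ a → r ≡ r′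
CongMod-residue-unique {a} {n} {r} {r′} r<a r′<a (k , n≡r+ka) (k′ , n≡r′+k′a) = begin
  r                 ≡⟨ m<n⇒m%n≡m r<a ⟨
  r % a             ≡⟨ [m+kn]%n≡m%n r k a ⟨
  (r + k * a) % a   ≡⟨ cong (_% a) (trans (sym n≡r+ka) n≡r′+k′a) ⟩
  (r′ + k′ * a) % a ≡⟨ [m+kn]%n≡m%n r′ k′ a ⟩
  r′ % a            ≡⟨ m<n⇒m%n≡m r′<a ⟩
  r′                ∎
  where open ≡-Reasoning

module _ {a bs r n} (isN : IsN a bs r n) (r<a : r < a) where

  IsN-irreducible : ∀ {m} t → Rep bs m → m + t * a ≡ n → m ≡ n
  IsN-irreducible t rep m+ta≡n =
    ≤-antisym (≤-trans (m≤m+n _ (t * a)) (≤-reflexive m+ta≡n))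
              (proj₂ (proj₂ isN) _ (CongMod-cancel t (proj₁ isN) r<a m+ta≡n) rep)

  IsN-≢-+-multiple : ∀ {m t} → 0 < a → 0 < t → Rep bs m → m + t * a ≢ n
  IsN-≢-+-multiple {m} {t} a>0 t>0 rep m+ta≡n = <⇒≢ (*-mono-< t>0 a>0) (sym ta≡0)
    where
    ta≡0 : t * a ≡ 0
    ta≡0 = +-cancelˡ-≡ m _ _
      (trans m+ta≡n (trans (sym (IsN-irreducible t rep m+ta≡n)) (sym (+-identityʳ m))))

IsN-residue-unique : ∀ {a bs r r′ n} .{{_ : NonZero a}} → r < a → r′ < a →
                     IsN a bs r n → IsN a bs r′ n → r ≡ r′
IsN-residue-unique r<a r′<a (n≡r , _) (n≡r′ , _) = CongMod-residue-unique r<a r′<a n≡r n≡r′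

m<[1+m/n]*n : ∀ m n .{{_ : NonZero n}} → m < suc (m / n) * n
m<[1+m/n]*n m n = begin-strict
  m                 ≡⟨ m≡m%n+[m/n]*n m n ⟩
  m % n + m / n * n <⟨ +-monoˡ-< (m / n * n) (m%n<n m n) ⟩
  suc (m / n) * n   ∎
  where open ≤-Reasoning

[m∸n]+[m+n]≡2*m : ∀ {m n} → n ≤ m → m ∸ n + (m + n) ≡ 2 * m
[m∸n]+[m+n]≡2*m {m} {n} n≤m = begin
  m ∸ n + (m + n) ≡⟨ +-assoc (m ∸ n) m n ⟨
  m ∸ n + m + n   ≡⟨ +-comm (m ∸ n + m) n ⟩
  n + (m ∸ n + m) ≡⟨ +-assoc n (m ∸ n) m ⟨
  n + (m ∸ n) + m ≡⟨ cong (_+ m) (m+[n∸m]≡n n≤m) ⟩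
  m + m           ≡⟨ cong (_+_ m) (+-identityʳ m) ⟨
  2 * m           ∎
  where open ≡-Reasoning

module Exchange {a b c q : ℕ} (b+c≡qa : b + c ≡ q * a) where

  open ≡-Reasoning
  open ℕ-Solver using (solve)

  b*a+c*y≡b*u+y*q*a : ∀ {y u} → y + u ≡ a → b * a + c * y ≡ b * u + y * q * a
  b*a+c*y≡b*u+y*q*a {y} {u} y+u≡a = begin
    b * a + c * y         ≡⟨ cong (λ s → b * s + c * y) (sym y+u≡a) ⟩
    b * (y + u) + c * y   ≡⟨ solve (b ∷ c ∷ y ∷ u ∷ []) ⟩
    b * u + y * (b + c)   ≡⟨ cong (λ s → b * u + y * s) b+c≡qa ⟩
    b * u + y * (q * a)   ≡⟨ solve (b ∷ u ∷ y ∷ q ∷ a ∷ []) ⟩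
    b * u + y * q * a     ∎

  c*y≡b*u+v*a : ∀ {y u v} → y + u ≡ a → b + v ≡ y * q → c * y ≡ b * u + v * a
  c*y≡b*u+v*a {y} {u} {v} y+u≡a b+v≡yq = +-cancelˡ-≡ (b * a) _ _ (begin
    b * a + c * y         ≡⟨ b*a+c*y≡b*u+y*q*a y+u≡a ⟩
    b * u + y * q * a     ≡⟨ cong (λ s → b * u + s * a) (sym b+v≡yq) ⟩
    b * u + (b + v) * a   ≡⟨ solve (b ∷ u ∷ v ∷ a ∷ []) ⟩
    b * a + (b * u + v * a) ∎)

  b*x≡c*j+w*a : ∀ {x j w} → j + x ≡ a → j * q + w ≡ b → b * x ≡ c * j + w * a
  b*x≡c*j+w*a {x} {j} {w} j+x≡a jq+w≡b = +-cancelˡ-≡ (j * q * a) _ _ (begin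
    j * q * a + b * x           ≡⟨ +-comm _ (b * x) ⟩
    b * x + j * q * a           ≡⟨ b*a+c*y≡b*u+y*q*a j+x≡a ⟨
    b * a + c * j               ≡⟨ cong (λ s → s * a + c * j) (sym jq+w≡b) ⟩
    (j * q + w) * a + c * j     ≡⟨ solve (j ∷ q ∷ w ∷ a ∷ c ∷ []) ⟩
    j * q * a + (c * j + w * a) ∎)

module ResidueMinima
  {a b c q R : ℕ} (a>0 : 0 < a) (b>0 : 0 < b) (c>0 : 0 < c)
  (b+c≡qa : b + c ≡ q * a) (Rq≤b : R * q ≤ b) (b<[1+R]q : b < suc R * q)
  (N : ℕ → ℕ) (isN : ∀ r → r < a → IsN a (b ∷ c ∷ []) r (N r)) where

  open ℕ-Solver using (solve)
  open Exchange {a} {b} {c} {q} b+c≡qa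

  M : ℕ → ℕ
  M j with j ≤? R
  ... | yes _ = c * j
  ... | no  _ = b * (j ∸ R)

  M-≤ : ∀ {j} → j ≤ R → M j ≡ c * j
  M-≤ {j} j≤R with j ≤? R
  ... | yes _   = refl
  ... | no  j≰R = contradiction j≤R j≰R

  M-> : ∀ {j} → R < j → M j ≡ b * (j ∸ R)
  M-> {j} R<j with j ≤? R
  ... | yes j≤R = contradiction j≤R (<⇒≱ R<j)
  ... | no  _   = refl

  q>0 : 0 < q
  q>0 = n≢0⇒n>0 λ q≡0 →
    <⇒≱ b<[1+R]q (subst (_≤ b) (sym (trans (cong (suc R *_) q≡0) (*-zeroʳ (suc R)))) z≤n)

  R<a : R < a
  R<a = *-cancelʳ-< q R a (≤-<-trans Rq≤b (<-≤-trans b<b+c (≤-reflexive (trans b+c≡qa (*-comm q a)))))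
    where
    b<b+c : b < b + c
    b<b+c = m<m+n b c>0

  N-irreducible : ∀ {r m} t → r < a → Rep (b ∷ c ∷ []) m → m + t * a ≡ N r → m ≡ N r
  N-irreducible {r} t r<a = IsN-irreducible {bs = b ∷ c ∷ []} (isN r r<a) r<a t

  N-≢-+-multiple : ∀ {r m t} → r < a → 0 < t → Rep (b ∷ c ∷ []) m → m + t * a ≢ N r
  N-≢-+-multiple {r} r<a = IsN-≢-+-multiple {bs = b ∷ c ∷ []} (isN r r<a) r<a a>0

  N≢large-multiple : ∀ {r e y} → r < a → 0 < e → (∀ k → Rep (b ∷ c ∷ []) (e * k)) → a ≤ y → N r ≢ e * y
  N≢large-multiple {r} {e} {y} r<a e>0 rep a≤y N≡ey with m≤n⇒∃[o]m+o≡n a≤y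
  ... | k , a+k≡y = N-≢-+-multiple r<a e>0 (rep k) (begin
    e * k + e * a ≡⟨ solve (e ∷ k ∷ a ∷ []) ⟩
    e * (a + k)   ≡⟨ cong (e *_) a+k≡y ⟩
    e * y         ≡⟨ N≡ey ⟨
    N r           ∎)
    where open ≡-Reasoning

  N≢b*[1+x]+c*[1+y] : ∀ {r x y} → r < a → N r ≢ b * suc x + c * suc y
  N≢b*[1+x]+c*[1+y] {r} {x} {y} r<a N≡ =
    N-≢-+-multiple r<a q>0 (Rep-pair b c x y) (begin
      b * x + c * y + q * a   ≡⟨ cong (_+_ (b * x + c * y)) b+c≡qa ⟨
      b * x + c * y + (b + c) ≡⟨ solve (b ∷ c ∷ x ∷ y ∷ []) ⟩
      b * suc x + c * suc y   ≡⟨ N≡ ⟨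
      N r                     ∎)
    where open ≡-Reasoning

  N≡c*y⇒enumerated : ∀ {r y} → r < a → N r ≡ c * y → ∃ λ j → j < a × N r ≡ M j
  N≡c*y⇒enumerated {r} {y} r<a N≡cy with y ≤? R | a ≤? y
  ... | yes y≤R | _       = y , ≤-<-trans y≤R R<a , trans N≡cy (sym (M-≤ y≤R))
  ... | no  _   | yes a≤y = contradiction N≡cy (N≢large-multiple r<a c>0 (Rep-right b c) a≤y)
  ... | no  y≰R | no  a≰y =
    contradiction (sym (trans N≡cy (c*y≡b*u+v*a y+[a∸y]≡a b+[yq∸b]≡yq)))
                  (N-≢-+-multiple r<a (m<n⇒0<n∸m b<yq) (Rep-left b c (a ∸ y)))
    where
    y+[a∸y]≡a : y + (a ∸ y) ≡ a
    y+[a∸y]≡a = m+[n∸m]≡n (<⇒≤ (≰⇒> a≰y))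
    b<yq : b < y * q
    b<yq = <-≤-trans b<[1+R]q (*-monoˡ-≤ q (≰⇒> y≰R))
    b+[yq∸b]≡yq : b + (y * q ∸ b) ≡ y * q
    b+[yq∸b]≡yq = m+[n∸m]≡n (<⇒≤ b<yq)

  N≡b*x⇒enumerated : ∀ {r x} → r < a → 0 < x → N r ≡ b * x → ∃ λ j → j < a × N r ≡ M j
  N≡b*x⇒enumerated {r} {x} r<a x>0 N≡bx with a ≤? x | R + x <? a
  ... | yes a≤x | _ = contradiction N≡bx (N≢large-multiple r<a b>0 (Rep-left b c) a≤x)
  ... | no _ | yes R+x<a =
    R + x , R+x<a , trans N≡bx (sym (trans (M-> (m<m+n R x>0)) (cong (b *_) (m+n∸m≡n R x))))
  ... | no a≰x | no R+x≮a =
    j , j<a , trans (sym (N-irreducible (b ∸ j * q) r<a (Rep-right b c j) c*j+w*a≡N)) (sym (M-≤ j≤R))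
    where
    j : ℕ
    j = a ∸ x
    j+x≡a : j + x ≡ a
    j+x≡a = m∸n+n≡m (<⇒≤ (≰⇒> a≰x))
    j<a : j < a
    j<a = subst (j <_) j+x≡a (m<m+n j x>0)
    j≤R : j ≤ R
    j≤R = ≤-trans (∸-monoˡ-≤ x (≮⇒≥ R+x≮a)) (≤-reflexive (m+n∸n≡m R x))
    jq+w≡b : j * q + (b ∸ j * q) ≡ b
    jq+w≡b = m+[n∸m]≡n (≤-trans (*-monoˡ-≤ q j≤R) Rq≤b)
    c*j+w*a≡N : c * j + (b ∸ j * q) * a ≡ N r
    c*j+w*a≡N = trans (sym (b*x≡c*j+w*a j+x≡a jq+w≡b)) (sym N≡bx)

  N-enumerated : ∀ r → r < a → ∃ λ j → j < a × N r ≡ M j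
  N-enumerated r r<a with Rep-pair⁻¹ {b} {c} (proj₁ (proj₂ (isN r r<a)))
  ... | 0     , y     , N≡ = N≡c*y⇒enumerated {y = y} r<a (trans N≡ (solve (b ∷ c ∷ y ∷ [])))
  ... | suc x , 0     , N≡ = N≡b*x⇒enumerated {x = suc x} r<a 0<1+n (trans N≡ (solve (b ∷ c ∷ x ∷ [])))
  ... | suc x , suc y , N≡ = contradiction N≡ (N≢b*[1+x]+c*[1+y] r<a)

  τ : Fin a → Fin a
  τ i = fromℕ< (proj₁ (proj₂ (N-enumerated (toℕ i) (toℕ<n i))))

  N≡M∘τ : ∀ i → N (toℕ i) ≡ M (toℕ (τ i))
  N≡M∘τ i with N-enumerated (toℕ i) (toℕ<n i)
  ... | j , j<a , N≡Mj = trans N≡Mj (cong M (sym (toℕ-fromℕ< j<a)))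

  N-injective : ∀ {r r′} → r < a → r′ < a → N r ≡ N r′ → r ≡ r′
  N-injective {r} {r′} r<a r′<a Nr≡Nr′ =
    IsN-residue-unique {bs = b ∷ c ∷ []} {{>-nonZero a>0}} r<a r′<a
      (isN r r<a) (subst (IsN a (b ∷ c ∷ []) r′) (sym Nr≡Nr′) (isN r′ r′<a))

  τ-injective : Injective _≡_ _≡_ τ
  τ-injective {i} {i′} τi≡τi′ = toℕ-injective (N-injective (toℕ<n i) (toℕ<n i′)
    (trans (N≡M∘τ i) (trans (cong (M ∘ toℕ) τi≡τi′) (sym (N≡M∘τ i′)))))

  f≡∑M : ∀ x → f N a x ≡ ∑ a (λ j → x ℤ.^ M j)
  f≡∑M x = begin
    f N a x                                    ≡⟨ foldr-applyUpTo≡∑ (λ r → x ℤ.^ N r) id a ⟩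
    ∑ a (λ r → x ℤ.^ N r)                      ≡⟨ sum≡∑ (λ r → x ℤ.^ N r) a ⟨
    FinSum.sum {a} (λ i → x ℤ.^ N (toℕ i))     ≡⟨ FinSum.sum-cong-≗ (cong (x ℤ.^_) ∘ N≡M∘τ) ⟩
    FinSum.sum {a} (λ i → x ℤ.^ M (toℕ (τ i))) ≡⟨ sum-reindex τ τ-injective (λ j → x ℤ.^ M (toℕ j)) ⟨
    FinSum.sum {a} (λ j → x ℤ.^ M (toℕ j))     ≡⟨ sum≡∑ (λ j → x ℤ.^ M j) a ⟩
    ∑ a (λ j → x ℤ.^ M j)                      ∎
    where open ≡-Reasoning

  ∑M≡blocks : ∀ x → ∑ a (λ j → x ℤ.^ M j)
            ≡ ∑ (R + 1) ((x ℤ.^ c) ℤ.^_) ℤ.+ x ℤ.^ b ℤ.* ∑ (a ∸ R ∸ 1) ((x ℤ.^ b) ℤ.^_)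
  ∑M≡blocks x = begin
    ∑ a (λ j → x ℤ.^ M j)                    ≡⟨ cong (λ n → ∑ n (λ j → x ℤ.^ M j)) (sym a≡R+1+m) ⟩
    ∑ (R + 1 + m) (λ j → x ℤ.^ M j)          ≡⟨ ∑-+ (λ j → x ℤ.^ M j) (R + 1) m ⟩
    ∑ (R + 1) (λ j → x ℤ.^ M j) ℤ.+ ∑ m (λ i → x ℤ.^ M (R + 1 + i))
      ≡⟨ cong₂ ℤ._+_ (∑-cong (R + 1) lower-block) (∑-cong m upper-block) ⟩
    ∑ (R + 1) ((x ℤ.^ c) ℤ.^_) ℤ.+ ∑ m (λ i → x ℤ.^ b ℤ.* (x ℤ.^ b) ℤ.^ i)
      ≡⟨ cong (ℤ._+_ (∑ (R + 1) ((x ℤ.^ c) ℤ.^_))) (∑-*ˡ (x ℤ.^ b) ((x ℤ.^ b) ℤ.^_) m) ⟩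
    ∑ (R + 1) ((x ℤ.^ c) ℤ.^_) ℤ.+ x ℤ.^ b ℤ.* ∑ m ((x ℤ.^ b) ℤ.^_) ∎
    where
    open ≡-Reasoning
    m : ℕ
    m = a ∸ R ∸ 1
    a≡R+1+m : R + 1 + m ≡ a
    a≡R+1+m = trans (cong (_+_ (R + 1)) (∸-+-assoc a R 1)) (m+[n∸m]≡n (subst (_≤ a) (+-comm 1 R) R<a))
    lower-block : ∀ {i} → i < R + 1 → x ℤ.^ M i ≡ (x ℤ.^ c) ℤ.^ i
    lower-block {i} i<R+1 = trans (cong (x ℤ.^_) (M-≤ (m<1+n⇒m≤n (subst (i <_) (+-comm R 1) i<R+1))))
                                  (sym (ℤₚ.^-*-assoc x c i))
    upper-block : ∀ {i} → i < m → x ℤ.^ M (R + 1 + i) ≡ x ℤ.^ b ℤ.* (x ℤ.^ b) ℤ.^ i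
    upper-block {i} _ = begin
      x ℤ.^ M (R + 1 + i)          ≡⟨ cong (λ k → x ℤ.^ M k) (+-assoc R 1 i) ⟩
      x ℤ.^ M (R + suc i)          ≡⟨ cong (x ℤ.^_) (M-> (m<m+n R 0<1+n)) ⟩
      x ℤ.^ (b * (R + suc i ∸ R))  ≡⟨ cong (λ k → x ℤ.^ (b * k)) (m+n∸m≡n R (suc i)) ⟩
      x ℤ.^ (b * suc i)            ≡⟨ ℤₚ.^-*-assoc x b (suc i) ⟨
      (x ℤ.^ b) ℤ.^ suc i          ∎

propositionA3 : (a d h : ℕ) → (ha : 0 < a) → (hd : 0 < d) → (hh : 0 < h) →
    gcd a d ≡ 1 → d + 1 < h * a →
    (N : ℕ → ℕ) →
    (∀ r → r < a → IsN a ((h * a ∸ d) ∷ (h * a + d) ∷ []) r (N r)) →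
    ∀ (x : ℤ) →
      f N a x ℤ.* ((+ 1 ℤ.- x ℤ.^ (h * a + d)) ℤ.* (+ 1 ℤ.- x ℤ.^ (h * a ∸ d)))
      ≡ (+ 1 ℤ.- x ℤ.^ ((h * a + d) * (r₁ a d h hh ℕ.+ 1))) ℤ.* (+ 1 ℤ.- x ℤ.^ (h * a ∸ d))
        ℤ.+ (x ℤ.^ (h * a ∸ d)) ℤ.* (+ 1 ℤ.- x ℤ.^ ((h * a ∸ d) * (a ∸ r₁ a d h hh ∸ 1)))
            ℤ.* (+ 1 ℤ.- x ℤ.^ (h * a + d))
-- gcd a d ≡ 1 is only needed for the N_r to exist, and they are given.
propositionA3 a d h ha hd hh _ d+1<ha N isN x = begin
  f N a x ℤ.* ((+ 1 ℤ.- Y) ℤ.* (+ 1 ℤ.- Z))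
    ≡⟨ cong (ℤ._* ((+ 1 ℤ.- Y) ℤ.* (+ 1 ℤ.- Z))) (trans (f≡∑M x) (∑M≡blocks x)) ⟩
  (∑ (R + 1) (Y ℤ.^_) ℤ.+ Z ℤ.* ∑ m (Z ℤ.^_)) ℤ.* ((+ 1 ℤ.- Y) ℤ.* (+ 1 ℤ.- Z))
    ≡⟨ two-geometric-blocks Y Z (R + 1) m ⟩
  (+ 1 ℤ.- Y ℤ.^ (R + 1)) ℤ.* (+ 1 ℤ.- Z) ℤ.+ Z ℤ.* (+ 1 ℤ.- Z ℤ.^ m) ℤ.* (+ 1 ℤ.- Y)
    ≡⟨ cong₂ (λ s t → (+ 1 ℤ.- s) ℤ.* (+ 1 ℤ.- Z) ℤ.+ Z ℤ.* (+ 1 ℤ.- t) ℤ.* (+ 1 ℤ.- Y))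
             (ℤₚ.^-*-assoc x c (R + 1)) (ℤₚ.^-*-assoc x b m) ⟩
  (+ 1 ℤ.- x ℤ.^ (c * (R + 1))) ℤ.* (+ 1 ℤ.- Z) ℤ.+ Z ℤ.* (+ 1 ℤ.- x ℤ.^ (b * m)) ℤ.* (+ 1 ℤ.- Y) ∎
  where
  open ≡-Reasoning
  b c R m : ℕ
  b = h * a ∸ d
  c = h * a + d
  R = r₁ a d h hh
  m = a ∸ R ∸ 1
  Y Z : ℤ
  Y = x ℤ.^ c
  Z = x ℤ.^ b
  instance
    2h≢0 : NonZero (2 * h)
    2h≢0 = >-nonZero (*-monoʳ-< 2 hh)
  d<ha : d < h * a
  d<ha = <-trans (m<m+n d 0<1+n) d+1<ha
  b+c≡2ha : b + c ≡ 2 * h * a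
  b+c≡2ha = trans ([m∸n]+[m+n]≡2*m (<⇒≤ d<ha)) (sym (*-assoc 2 h a))
  open ResidueMinima {q = 2 * h} {R = R} ha (m<n⇒0<n∸m d<ha) (<-≤-trans hd (m≤n+m d (h * a)))
                     b+c≡2ha (m/n*n≤m b (2 * h)) (m<[1+m/n]*n b (2 * h)) N isN
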